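{- If two digraphs $X$ and $Y$ satisfy $U_X=U_Y$, then $X$ and $Y$ have the same number of vertices and the same number of edges that are not loops.
   Context: A digraph $X=(V,E)$ has a finite vertex set $V$, $|V|=n$, and $E\subseteq V\times V$; a loop is an edge $(v,v)$. A $V$-listing is a bijection $\pi:[n]\to V$, and $X\mathrm{Des}(\pi)=\{i\in[n-1]:(\pi_i,\pi_{i+1})\in E\}$. Let $F_I=\sum_{i_1\le\dots\le i_n,\ i_j<i_{j+1}\ (j\in I)}x_{i_1}\cdots x_{i_n}$ for $I\subseteq[n-1]$ (fundamental quasisymmetric functions). The Redei-Berge function is $U_X=\sum_\pi F_{X\mathrm{Des}(\pi)}$ over all $V$-listings. -}

module Defs where

open import Data.Nat using (ℕ; zero; suc; _+_; _∸_)
open import Data.Bool using (Bool; true; false; _∧_; _∨_; not; if_then_else_)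
open import Data.Fin using (Fin; _≤?_; _<?_)
open import Data.Fin.Properties using (_≟_)
open import Data.List using (List; []; _∷_; map; concatMap; filter; length; allFin)
open import Data.Nat.ListAction using (sum)
open import Data.Bool.Properties using () renaming (_≟_ to _≟ᵇ_)
open import Data.Vec using (Vec; tabulate)
open import Data.Vec.Properties using (≡-dec)
import Data.Nat as ℕ
open import Relation.Nullary.Decidable using (⌊_⌋; does)

-- A digraph on the vertex set Fin n: E u v = true iff (u , v) is an edge.
-- (Any finite vertex set is in bijection with some Fin n; loops allowed.)
Digraph : ℕ → Set
Digraph n = Fin n → Fin n → Bool

allLists : (n k : ℕ) → List (List (Fin k))
allLists zero    k = [] ∷ []
allLists (suc n) k = concatMap (λ x → map (x ∷_) (allLists n k)) (allFin k)

notIn : ∀ {k} → Fin k → List (Fin k) → Bool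
notIn x []       = true
notIn x (y ∷ ys) = not ⌊ x ≟ y ⌋ ∧ notIn x ys

distinct : ∀ {k} → List (Fin k) → Bool
distinct []       = true
distinct (x ∷ xs) = notIn x xs ∧ distinct xs

-- V-listings π = (π_1,…,π_n): bijections [n] → V, i.e. lists of length n
-- over Fin n without repetition.
listings : (n : ℕ) → List (List (Fin n))
listings n = filter (λ π → distinct π ≟ᵇ true) (allLists n n)

-- X-descent set of a listing, as the characteristic vector of a subset of
-- [n-1]: the i-th entry (i = 1..n-1) is true iff (π_i , π_{i+1}) ∈ E.
xdes : ∀ {n} → Digraph n → List (Fin n) → List Bool
xdes E []           = []
xdes E (x ∷ [])     = []
xdes E (x ∷ y ∷ ys) = E x y ∷ xdes E (y ∷ ys)

-- A sequence i_1,…,i_n of variable indices is admissible for F_I when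
-- i_1 ≤ … ≤ i_n and i_j < i_{j+1} for j ∈ I (I given as a characteristic list).
admissible : ∀ {k} → List Bool → List (Fin k) → Bool
admissible bs       []           = true
admissible bs       (x ∷ [])     = true
admissible []       (x ∷ y ∷ ys) = false   -- length mismatch, never used
admissible (b ∷ bs) (x ∷ y ∷ ys) =
  ⌊ x ≤? y ⌋ ∧ (not b ∨ ⌊ x <? y ⌋) ∧ admissible bs (y ∷ ys)

occurrences : ∀ {k} → Fin k → List (Fin k) → ℕ
occurrences m []       = 0
occurrences m (x ∷ xs) = (if ⌊ m ≟ x ⌋ then 1 else 0) + occurrences m xs

expVec : ∀ {k} → List (Fin k) → Vec ℕ k
expVec {k} s = tabulate (λ m → occurrences m s)

-- Formal power series in countably many variables x_0, x_1, … are
-- represented by their coefficient functions: a monomial is given by a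
-- finite exponent vector a : Vec ℕ k (exponents of x_0 … x_{k-1}, all
-- other exponents zero).
--
-- Coefficient of x^a in the fundamental quasisymmetric function F_I of
-- degree n: the number of admissible index sequences of length n giving x^a.
coeffF : (n : ℕ) → List Bool → (k : ℕ) → Vec ℕ k → ℕ
coeffF n I k a =
  length (filter (λ s → ⌊ ≡-dec ℕ._≟_ (expVec s) a ⌋ ≟ᵇ true)
                 (filter (λ s → admissible I s ≟ᵇ true) (allLists n k)))

-- Coefficient of x^a in the Redei–Berge function U_X = Σ_π F_{XDes(π)}.
coeffU : ∀ {n} → Digraph n → (k : ℕ) → Vec ℕ k → ℕ
coeffU {n} E k a = sum (map (λ π → coeffF n (xdes E π) k a) (listings n))

_≐U_ : ∀ {n m} → Digraph n → Digraph m → Set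
X ≐U Y = ∀ (k : ℕ) (a : Vec ℕ k) → coeffU X k a ≡ coeffU Y k a
  where open import Relation.Binary.PropositionalEquality using (_≡_)

nonLoopEdges : ∀ {n} → Digraph n → ℕ
nonLoopEdges {n} E =
  sum (map (λ u → sum (map (λ v → if (E u v ∧ not ⌊ u ≟ v ⌋) then 1 else 0)
                              (allFin n)))
           (allFin n))

{-# OPTIONS --safe #-}
-- Admissible index sequences are weakly increasing, and a weakly increasing
-- sequence is determined by its exponent vector; so for weakly increasing t
-- the coefficient of x^(exponents of t) in F_I is 1 if t itself is
-- admissible for I and of the right length, and 0 otherwise. For x₀x₁⋯x_{k-1}
-- every listing of an n-vertex digraph then contributes 1 if k = n and 0
-- otherwise, so the coefficient in U_X is n! for k = n, which determines n.
-- For x₀²x₁⋯x_r (n = r + 2) a listing π contributes 1 exactly when (π₁, π₂)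
-- is not an edge; every non-loop edge (u, v) begins exactly r! listings, so
-- the coefficient is n! minus r! times the number of non-loop edges.
module Submission where

open import Defs
open import Data.Nat using (ℕ)
open import Data.Product using (_×_)
open import Relation.Binary.PropositionalEquality using (_≡_)

open import Algebra.Bundles using (CommutativeMonoid)
open import Data.Bool using (Bool; true; false; _∧_; _∨_; not; if_then_else_)
open import Data.Bool.Properties
  using (∧-zeroʳ; ∧-identityʳ; ∧-conicalˡ; ∧-conicalʳ; ∧-comm; ∧-assoc; ∨-zeroʳ; ∨-identityʳ; ∧-commutativeMonoid)
  renaming (_≟_ to _≟ᵇ_)
open import Algebra.Properties.CommutativeSemigroup (CommutativeMonoid.commutativeSemigroup ∧-commutativeMonoid)
  using () renaming (interchange to ∧-interchange)
open import Data.Fin as Fin using (Fin; zero; suc; _≤?_; _<?_)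
open import Data.Fin.Properties using (_≟_; <-cmp; <⇒≢)
open import Data.List using (List; []; _∷_; _++_; [_]; map; concatMap; filter; length; tabulate; allFin)
open import Data.List.Properties
  using (map-cong; map-cong-local; map-++; map-∘; map-tabulate; length-++; length-tabulate; ++-assoc; ++-identityʳ)
  renaming (≡-dec to ≡-decₗ)
open import Data.List.Relation.Unary.All as All using (All)
open import Data.List.Relation.Unary.All.Properties using (concat⁺; map⁺; filter⁺)
open import Data.List.Relation.Unary.Linked as Linked using (Linked; []; [-]; _∷_)
open import Data.Nat as ℕ using (zero; suc; _+_; _*_; _≤_; _!; z≤n; s≤s; z<s; s<s)
open import Data.Nat.ListAction using (sum)
open import Data.Nat.ListAction.Properties using (sum-++)
open import Data.Nat.Properties
  using ( +-identityʳ; +-suc; +-assoc; *-identityˡ; *-identityʳ; *-zeroʳ; *-assoc; *-comm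
        ; *-suc; *-distribˡ-+; *-distribʳ-+; +-cancelˡ-≡; *-cancelʳ-≡; _!≢0; 0≢1+n; 1+n≢0; <⇒≤; <-≤-trans; ≤-refl
        ; +-commutativeSemigroup)
open import Algebra.Properties.CommutativeSemigroup +-commutativeSemigroup
  using () renaming (interchange to +-interchange)
open import Data.Product using (_,_)
open import Data.Vec using (Vec; lookup)
open import Data.Vec.Properties using (lookup∘tabulate) renaming (≡-dec to ≡-decᵥ)
open import Function using (_∘_; id)
open import Relation.Binary.Definitions using (DecidableEquality; tri<; tri≈; tri>)
open import Relation.Binary.PropositionalEquality
  using (_≢_; refl; sym; trans; cong; cong₂; subst; _≗_; module ≡-Reasoning)
open import Relation.Nullary using (Dec; yes; no; ¬_)
open import Relation.Nullary.Decidable using (⌊_⌋; isYes≗does; dec-true; dec-false; ⌊⌋-map′)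
open import Relation.Nullary.Negation using (contradiction)

open ≡-Reasoning

⌊⌋-yes : ∀ {A : Set} (a? : Dec A) → A → ⌊ a? ⌋ ≡ true
⌊⌋-yes a? a = trans (isYes≗does a?) (dec-true a? a)

⌊⌋-no : ∀ {A : Set} (a? : Dec A) → ¬ A → ⌊ a? ⌋ ≡ false
⌊⌋-no a? ¬a = trans (isYes≗does a?) (dec-false a? ¬a)

⟦_⟧ : Bool → ℕ
⟦ b ⟧ = if b then 1 else 0

⟦∧⟧ : ∀ a b → ⟦ a ∧ b ⟧ ≡ ⟦ a ⟧ * ⟦ b ⟧
⟦∧⟧ false b = refl
⟦∧⟧ true  b = sym (+-identityʳ ⟦ b ⟧)

⟦not⟧+⟦⟧ : ∀ b → ⟦ not b ⟧ + ⟦ b ⟧ ≡ 1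
⟦not⟧+⟦⟧ false = refl
⟦not⟧+⟦⟧ true  = refl

⟦⟧*⟦⟧+⟦not∧⟧ : ∀ a c → ⟦ a ⟧ * ⟦ c ⟧ + ⟦ not a ∧ c ⟧ ≡ ⟦ c ⟧
⟦⟧*⟦⟧+⟦not∧⟧ false c = refl
⟦⟧*⟦⟧+⟦not∧⟧ true  false = refl
⟦⟧*⟦⟧+⟦not∧⟧ true  true  = refl

∑ : ∀ {A : Set} → List A → (A → ℕ) → ℕ
∑ xs f = sum (map f xs)

syntax ∑ xs (λ x → e) = ∑[ x ∈ xs ] e

module _ {A : Set} where

  ∑-cong : ∀ {f g : A → ℕ} → f ≗ g → ∀ xs → ∑ xs f ≡ ∑ xs g
  ∑-cong f≗g xs = cong sum (map-cong f≗g xs)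

  ∑-cong-All : ∀ {P : A → Set} {f g : A → ℕ} {xs} →
               (∀ {x} → P x → f x ≡ g x) → All P xs → ∑ xs f ≡ ∑ xs g
  ∑-cong-All f≡g ps = cong sum (map-cong-local (All.map f≡g ps))

  ∑-const : ∀ c (xs : List A) → ∑[ _ ∈ xs ] c ≡ c * length xs
  ∑-const c []       = sym (*-zeroʳ c)
  ∑-const c (x ∷ xs) = begin
    c + ∑[ _ ∈ xs ] c      ≡⟨ cong (c +_) (∑-const c xs) ⟩
    c + c * length xs      ≡⟨ *-suc c (length xs) ⟨
    c * suc (length xs)    ∎

  ∑-+ : ∀ (f g : A → ℕ) xs → ∑[ x ∈ xs ] (f x + g x) ≡ ∑ xs f + ∑ xs g
  ∑-+ f g []       = refl
  ∑-+ f g (x ∷ xs) = begin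
    f x + g x + ∑[ y ∈ xs ] (f y + g y)  ≡⟨ cong (f x + g x +_) (∑-+ f g xs) ⟩
    f x + g x + (∑ xs f + ∑ xs g)        ≡⟨ +-interchange (f x) (g x) (∑ xs f) (∑ xs g) ⟩
    f x + ∑ xs f + (g x + ∑ xs g)        ∎

  ∑-*ˡ : ∀ c (f : A → ℕ) xs → ∑[ x ∈ xs ] (c * f x) ≡ c * ∑ xs f
  ∑-*ˡ c f []       = sym (*-zeroʳ c)
  ∑-*ˡ c f (x ∷ xs) = trans (cong (c * f x +_) (∑-*ˡ c f xs)) (sym (*-distribˡ-+ c (f x) (∑ xs f)))

  ∑-*ʳ : ∀ c (f : A → ℕ) xs → ∑[ x ∈ xs ] (f x * c) ≡ ∑ xs f * c
  ∑-*ʳ c f []       = refl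
  ∑-*ʳ c f (x ∷ xs) = trans (cong (f x * c +_) (∑-*ʳ c f xs)) (sym (*-distribʳ-+ c (f x) (∑ xs f)))

  ∑-not : ∀ (p : A → Bool) xs → ∑[ x ∈ xs ] ⟦ not (p x) ⟧ + ∑[ x ∈ xs ] ⟦ p x ⟧ ≡ length xs
  ∑-not p xs = begin
    ∑[ x ∈ xs ] ⟦ not (p x) ⟧ + ∑[ x ∈ xs ] ⟦ p x ⟧  ≡⟨ ∑-+ (λ x → ⟦ not (p x) ⟧) (λ x → ⟦ p x ⟧) xs ⟨
    ∑[ x ∈ xs ] (⟦ not (p x) ⟧ + ⟦ p x ⟧)           ≡⟨ ∑-cong (⟦not⟧+⟦⟧ ∘ p) xs ⟩
    ∑[ _ ∈ xs ] 1                                   ≡⟨ ∑-const 1 xs ⟩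
    1 * length xs                                   ≡⟨ *-identityˡ (length xs) ⟩
    length xs                                       ∎

  ∑-filter : ∀ (p : A → Bool) (f : A → ℕ) xs →
             ∑ (filter (λ x → p x ≟ᵇ true) xs) f ≡ ∑[ x ∈ xs ] (⟦ p x ⟧ * f x)
  ∑-filter p f []       = refl
  ∑-filter p f (x ∷ xs) with p x
  ... | true  = cong₂ _+_ (sym (+-identityʳ (f x))) (∑-filter p f xs)
  ... | false = ∑-filter p f xs

  length-filter : ∀ (p : A → Bool) xs → length (filter (λ x → p x ≟ᵇ true) xs) ≡ ∑[ x ∈ xs ] ⟦ p x ⟧
  length-filter p []       = refl
  length-filter p (x ∷ xs) with p x
  ... | true  = cong suc (length-filter p xs)
  ... | false = length-filter p xs

module _ {A B : Set} where

  ∑-map : ∀ (f : B → ℕ) (g : A → B) xs → ∑ (map g xs) f ≡ ∑[ x ∈ xs ] f (g x)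
  ∑-map f g xs = cong sum (sym (map-∘ xs))

  ∑-concatMap : ∀ (f : B → ℕ) (g : A → List B) xs → ∑ (concatMap g xs) f ≡ ∑[ x ∈ xs ] ∑ (g x) f
  ∑-concatMap f g []       = refl
  ∑-concatMap f g (x ∷ xs) = begin
    sum (map f (g x ++ concatMap g xs))  ≡⟨ cong sum (map-++ f (g x) (concatMap g xs)) ⟩
    sum (map f (g x) ++ map f (concatMap g xs))  ≡⟨ sum-++ (map f (g x)) _ ⟩
    ∑ (g x) f + ∑ (concatMap g xs) f  ≡⟨ cong (∑ (g x) f +_) (∑-concatMap f g xs) ⟩
    ∑ (g x) f + ∑[ y ∈ xs ] ∑ (g y) f  ∎

∑-allFin-suc : ∀ {k} (f : Fin (suc k) → ℕ) → ∑ (allFin (suc k)) f ≡ f zero + ∑[ i ∈ allFin k ] f (suc i)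
∑-allFin-suc f = cong (λ fs → f zero + sum fs) (trans (map-tabulate suc f) (sym (map-tabulate id (f ∘ suc))))

∑-allFin-≟ : ∀ {k} (y : Fin k) → ∑[ x ∈ allFin k ] ⟦ ⌊ x ≟ y ⌋ ⟧ ≡ 1
∑-allFin-≟ {suc k} zero = begin
  ∑[ x ∈ allFin (suc k) ] ⟦ ⌊ x ≟ zero ⌋ ⟧  ≡⟨ ∑-allFin-suc {k} (λ x → ⟦ ⌊ x ≟ zero ⌋ ⟧) ⟩
  1 + ∑[ _ ∈ allFin k ] 0                   ≡⟨ cong suc (∑-const 0 (allFin k)) ⟩
  1                                         ∎
∑-allFin-≟ {suc k} (suc y) = begin
  ∑[ x ∈ allFin (suc k) ] ⟦ ⌊ x ≟ suc y ⌋ ⟧  ≡⟨ ∑-allFin-suc {k} (λ x → ⟦ ⌊ x ≟ suc y ⌋ ⟧) ⟩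
  ∑[ x ∈ allFin k ] ⟦ ⌊ suc x ≟ suc y ⌋ ⟧     ≡⟨ ∑-cong (λ x → cong ⟦_⟧ (⌊⌋-map′ _ _ (x ≟ y))) (allFin k) ⟩
  ∑[ x ∈ allFin k ] ⟦ ⌊ x ≟ y ⌋ ⟧             ≡⟨ ∑-allFin-≟ y ⟩
  1                                           ∎

∑-allFin-sift : ∀ {k} (y : Fin k) (g : Fin k → ℕ) → ∑[ x ∈ allFin k ] (⟦ ⌊ x ≟ y ⌋ ⟧ * g x) ≡ g y
∑-allFin-sift {k} y g = begin
  ∑[ x ∈ allFin k ] (⟦ ⌊ x ≟ y ⌋ ⟧ * g x)  ≡⟨ ∑-cong at-y (allFin k) ⟩
  ∑[ x ∈ allFin k ] (⟦ ⌊ x ≟ y ⌋ ⟧ * g y)  ≡⟨ ∑-*ʳ (g y) (λ x → ⟦ ⌊ x ≟ y ⌋ ⟧) (allFin k) ⟩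
  ∑[ x ∈ allFin k ] ⟦ ⌊ x ≟ y ⌋ ⟧ * g y    ≡⟨ cong (_* g y) (∑-allFin-≟ y) ⟩
  1 * g y                                  ≡⟨ *-identityˡ (g y) ⟩
  g y                                      ∎
  where
  at-y : ∀ x → ⟦ ⌊ x ≟ y ⌋ ⟧ * g x ≡ ⟦ ⌊ x ≟ y ⌋ ⟧ * g y
  at-y x with x ≟ y
  ... | yes refl = refl
  ... | no _     = refl

infix 4 _≟ₗ_

_≟ₗ_ : ∀ {k} → DecidableEquality (List (Fin k))
_≟ₗ_ = ≡-decₗ _≟_

-- ⌊_⌋ is isYes, which unlike does does not compute through map′: these are not refl.
⌊∷≟ₗ∷⌋ : ∀ {k} (y x : Fin k) s t → ⌊ (y ∷ s) ≟ₗ (x ∷ t) ⌋ ≡ ⌊ y ≟ x ⌋ ∧ ⌊ s ≟ₗ t ⌋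
⌊∷≟ₗ∷⌋ y x s t = trans (isYes≗does _) (sym (cong₂ _∧_ (isYes≗does (y ≟ x)) (isYes≗does (s ≟ₗ t))))

⌊suc≟suc⌋ : ∀ m n → ⌊ suc m ℕ.≟ suc n ⌋ ≡ ⌊ m ℕ.≟ n ⌋
⌊suc≟suc⌋ m n = trans (isYes≗does (suc m ℕ.≟ suc n)) (sym (isYes≗does (m ℕ.≟ n)))

∑-allLists-suc : ∀ n k (f : List (Fin k) → ℕ) →
                 ∑ (allLists (suc n) k) f ≡ ∑[ x ∈ allFin k ] ∑[ s ∈ allLists n k ] f (x ∷ s)
∑-allLists-suc n k f = trans (∑-concatMap f _ (allFin k)) (∑-cong (λ x → ∑-map f (x ∷_) (allLists n k)) (allFin k))

allLists-ofLength : ∀ n k → All (λ s → length s ≡ n) (allLists n k)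
allLists-ofLength zero    k = refl All.∷ All.[]
allLists-ofLength (suc n) k =
  concat⁺ (map⁺ (All.universal (λ _ → map⁺ (All.map (cong suc) (allLists-ofLength n k))) (allFin k)))

∑-allLists-≟ : ∀ m {k} (t : List (Fin k)) →
               ∑[ s ∈ allLists m k ] ⟦ ⌊ s ≟ₗ t ⌋ ⟧ ≡ ⟦ ⌊ length t ℕ.≟ m ⌋ ⟧
∑-allLists-≟ zero    []      = refl
∑-allLists-≟ zero    (x ∷ t) = refl
∑-allLists-≟ (suc m) {k} []  = begin
  ∑[ s ∈ allLists (suc m) k ] ⟦ ⌊ s ≟ₗ [] ⌋ ⟧       ≡⟨ ∑-allLists-suc m k (λ s → ⟦ ⌊ s ≟ₗ [] ⌋ ⟧) ⟩
  ∑[ x ∈ allFin k ] ∑[ s ∈ allLists m k ] 0           ≡⟨ ∑-cong (λ _ → ∑-const 0 (allLists m k)) (allFin k) ⟩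
  ∑[ x ∈ allFin k ] 0                                 ≡⟨ ∑-const 0 (allFin k) ⟩
  0                                                   ∎
∑-allLists-≟ (suc m) {k} (x ∷ t) = begin
  ∑[ s ∈ allLists (suc m) k ] ⟦ ⌊ s ≟ₗ x ∷ t ⌋ ⟧
    ≡⟨ ∑-allLists-suc m k (λ s → ⟦ ⌊ s ≟ₗ x ∷ t ⌋ ⟧) ⟩
  ∑[ y ∈ allFin k ] ∑[ s ∈ allLists m k ] ⟦ ⌊ y ∷ s ≟ₗ x ∷ t ⌋ ⟧
    ≡⟨ ∑-cong (λ y → ∑-cong (λ s → ⟦∷≟ₗ∷⟧ y s) (allLists m k)) (allFin k) ⟩
  ∑[ y ∈ allFin k ] ∑[ s ∈ allLists m k ] (⟦ ⌊ y ≟ x ⌋ ⟧ * ⟦ ⌊ s ≟ₗ t ⌋ ⟧)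
    ≡⟨ ∑-cong (λ y → ∑-*ˡ ⟦ ⌊ y ≟ x ⌋ ⟧ (λ s → ⟦ ⌊ s ≟ₗ t ⌋ ⟧) (allLists m k)) (allFin k) ⟩
  ∑[ y ∈ allFin k ] (⟦ ⌊ y ≟ x ⌋ ⟧ * ∑[ s ∈ allLists m k ] ⟦ ⌊ s ≟ₗ t ⌋ ⟧)
    ≡⟨ ∑-allFin-sift x (λ _ → ∑[ s ∈ allLists m k ] ⟦ ⌊ s ≟ₗ t ⌋ ⟧) ⟩
  ∑[ s ∈ allLists m k ] ⟦ ⌊ s ≟ₗ t ⌋ ⟧
    ≡⟨ ∑-allLists-≟ m t ⟩
  ⟦ ⌊ length t ℕ.≟ m ⌋ ⟧
    ≡⟨ cong ⟦_⟧ (⌊suc≟suc⌋ (length t) m) ⟨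
  ⟦ ⌊ length (x ∷ t) ℕ.≟ suc m ⌋ ⟧
    ∎
  where
  ⟦∷≟ₗ∷⟧ : ∀ y s → ⟦ ⌊ y ∷ s ≟ₗ x ∷ t ⌋ ⟧ ≡ ⟦ ⌊ y ≟ x ⌋ ⟧ * ⟦ ⌊ s ≟ₗ t ⌋ ⟧
  ⟦∷≟ₗ∷⟧ y s = trans (cong ⟦_⟧ (⌊∷≟ₗ∷⌋ y x s t)) (⟦∧⟧ ⌊ y ≟ x ⌋ ⌊ s ≟ₗ t ⌋)

⌊≟⌋-sym : ∀ {k} (x y : Fin k) → ⌊ x ≟ y ⌋ ≡ ⌊ y ≟ x ⌋
⌊≟⌋-sym x y with x ≟ y | y ≟ x
... | yes _   | yes _   = refl
... | no _    | no _    = refl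
... | yes x≡y | no y≢x  = contradiction (sym x≡y) y≢x
... | no x≢y  | yes y≡x = contradiction (sym y≡x) x≢y

notIn-snoc : ∀ {k} (y : Fin k) P x → notIn y (P ++ [ x ]) ≡ notIn y P ∧ not ⌊ y ≟ x ⌋
notIn-snoc y []      x = ∧-identityʳ (not ⌊ y ≟ x ⌋)
notIn-snoc y (z ∷ P) x =
  trans (cong (not ⌊ y ≟ z ⌋ ∧_) (notIn-snoc y P x)) (sym (∧-assoc (not ⌊ y ≟ z ⌋) (notIn y P) _))

distinct-snoc : ∀ {k} (P : List (Fin k)) x → distinct (P ++ [ x ]) ≡ distinct (x ∷ P)
distinct-snoc []      x = refl
distinct-snoc (y ∷ P) x = begin
  notIn y (P ++ [ x ]) ∧ distinct (P ++ [ x ])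
    ≡⟨ cong₂ _∧_ (notIn-snoc y P x) (distinct-snoc P x) ⟩
  (notIn y P ∧ not ⌊ y ≟ x ⌋) ∧ (notIn x P ∧ distinct P)
    ≡⟨ cong (λ b → (notIn y P ∧ not b) ∧ (notIn x P ∧ distinct P)) (⌊≟⌋-sym y x) ⟩
  (notIn y P ∧ not ⌊ x ≟ y ⌋) ∧ (notIn x P ∧ distinct P)
    ≡⟨ cong (_∧ (notIn x P ∧ distinct P)) (∧-comm (notIn y P) _) ⟩
  (not ⌊ x ≟ y ⌋ ∧ notIn y P) ∧ (notIn x P ∧ distinct P)
    ≡⟨ ∧-interchange (not ⌊ x ≟ y ⌋) (notIn y P) (notIn x P) (distinct P) ⟩
  (not ⌊ x ≟ y ⌋ ∧ notIn x P) ∧ (notIn y P ∧ distinct P)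
    ∎

length+∑-notIn : ∀ {k} (P : List (Fin k)) → distinct P ≡ true →
                   length P + ∑[ x ∈ allFin k ] ⟦ notIn x P ⟧ ≡ k
length+∑-notIn {k} [] _ = begin
  ∑[ _ ∈ allFin k ] 1  ≡⟨ ∑-const 1 (allFin k) ⟩
  1 * length (allFin k) ≡⟨ *-identityˡ _ ⟩
  length (allFin k)    ≡⟨ length-tabulate id ⟩
  k                    ∎
length+∑-notIn {k} (y ∷ P) distinct-yP = begin
  suc (length P) + S′   ≡⟨ +-suc (length P) S′ ⟨
  length P + suc S′     ≡⟨ cong (length P +_) S≡1+S′ ⟨
  length P + S          ≡⟨ length+∑-notIn P (∧-conicalʳ _ _ distinct-yP) ⟩
  k                     ∎
  where
  S S′ : ℕ
  S  = ∑[ x ∈ allFin k ] ⟦ notIn x P ⟧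
  S′ = ∑[ x ∈ allFin k ] ⟦ notIn x (y ∷ P) ⟧
  S≡1+S′ : S ≡ suc S′
  S≡1+S′ = begin
    S  ≡⟨ ∑-cong (λ x → ⟦⟧*⟦⟧+⟦not∧⟧ ⌊ x ≟ y ⌋ (notIn x P)) (allFin k) ⟨
    ∑[ x ∈ allFin k ] (⟦ ⌊ x ≟ y ⌋ ⟧ * ⟦ notIn x P ⟧ + ⟦ notIn x (y ∷ P) ⟧)
       ≡⟨ ∑-+ (λ x → ⟦ ⌊ x ≟ y ⌋ ⟧ * ⟦ notIn x P ⟧) (λ x → ⟦ notIn x (y ∷ P) ⟧) (allFin k) ⟩
    ∑[ x ∈ allFin k ] (⟦ ⌊ x ≟ y ⌋ ⟧ * ⟦ notIn x P ⟧) + S′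
       ≡⟨ cong (_+ S′) (∑-allFin-sift y (λ x → ⟦ notIn x P ⟧)) ⟩
    ⟦ notIn y P ⟧ + S′
       ≡⟨ cong (λ b → ⟦ b ⟧ + S′) (∧-conicalˡ _ _ distinct-yP) ⟩
    suc S′ ∎

∑-distinct-∷ : ∀ {k r} (P : List (Fin k)) → length P + r ≡ k →
               ∑[ x ∈ allFin k ] ⟦ distinct (x ∷ P) ⟧ ≡ ⟦ distinct P ⟧ * r
∑-distinct-∷ {k} {r} P |P|+r≡k with distinct P in distinct-P
... | false = trans (∑-cong (λ x → cong ⟦_⟧ (∧-zeroʳ (notIn x P))) (allFin k)) (∑-const 0 (allFin k))
... | true  = begin
  ∑[ x ∈ allFin k ] ⟦ notIn x P ∧ true ⟧  ≡⟨ ∑-cong (λ x → cong ⟦_⟧ (∧-identityʳ (notIn x P))) (allFin k) ⟩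
  ∑[ x ∈ allFin k ] ⟦ notIn x P ⟧         ≡⟨ +-cancelˡ-≡ (length P) _ _
                                               (trans (length+∑-notIn P distinct-P) (sym |P|+r≡k)) ⟩
  r                                       ≡⟨ +-identityʳ r ⟨
  1 * r                                   ∎

∑-distinct-++ : ∀ r {k} (P : List (Fin k)) → length P + r ≡ k →
                ∑[ s ∈ allLists r k ] ⟦ distinct (P ++ s) ⟧ ≡ ⟦ distinct P ⟧ * r !
∑-distinct-++ zero P _ = begin
  ⟦ distinct (P ++ []) ⟧ + 0  ≡⟨ +-identityʳ _ ⟩
  ⟦ distinct (P ++ []) ⟧      ≡⟨ cong (⟦_⟧ ∘ distinct) (++-identityʳ P) ⟩
  ⟦ distinct P ⟧              ≡⟨ *-identityʳ _ ⟨
  ⟦ distinct P ⟧ * 1          ∎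
∑-distinct-++ (suc r) {k} P |P|+1+r≡k = begin
  ∑[ s ∈ allLists (suc r) k ] ⟦ distinct (P ++ s) ⟧
    ≡⟨ ∑-allLists-suc r k (λ s → ⟦ distinct (P ++ s) ⟧) ⟩
  ∑[ x ∈ allFin k ] ∑[ s ∈ allLists r k ] ⟦ distinct (P ++ x ∷ s) ⟧
    ≡⟨ ∑-cong (λ x → ∑-cong (cong (⟦_⟧ ∘ distinct) ∘ ++-assoc P [ x ]) (allLists r k)) (allFin k) ⟨
  ∑[ x ∈ allFin k ] ∑[ s ∈ allLists r k ] ⟦ distinct ((P ++ [ x ]) ++ s) ⟧
    ≡⟨ ∑-cong (λ x → ∑-distinct-++ r (P ++ [ x ]) (|P++x|+r≡k x)) (allFin k) ⟩
  ∑[ x ∈ allFin k ] (⟦ distinct (P ++ [ x ]) ⟧ * r !)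
    ≡⟨ ∑-cong (λ x → cong (λ b → ⟦ b ⟧ * r !) (distinct-snoc P x)) (allFin k) ⟩
  ∑[ x ∈ allFin k ] (⟦ distinct (x ∷ P) ⟧ * r !)
    ≡⟨ ∑-*ʳ (r !) (λ x → ⟦ distinct (x ∷ P) ⟧) (allFin k) ⟩
  ∑[ x ∈ allFin k ] ⟦ distinct (x ∷ P) ⟧ * r !
    ≡⟨ cong (_* r !) (∑-distinct-∷ P |P|+1+r≡k) ⟩
  ⟦ distinct P ⟧ * suc r * r !
    ≡⟨ *-assoc ⟦ distinct P ⟧ (suc r) (r !) ⟩
  ⟦ distinct P ⟧ * suc r !
    ∎
  where
  |P++x|+r≡k : ∀ x → length (P ++ [ x ]) + r ≡ k
  |P++x|+r≡k x = trans (cong (_+ r) (length-++ P)) (trans (+-assoc (length P) 1 r) |P|+1+r≡k)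

length-listings : ∀ n → length (listings n) ≡ n !
length-listings n = begin
  length (listings n)                       ≡⟨ length-filter distinct (allLists n n) ⟩
  ∑[ s ∈ allLists n n ] ⟦ distinct s ⟧      ≡⟨ ∑-distinct-++ n [] refl ⟩
  1 * n !                                   ≡⟨ *-identityˡ (n !) ⟩
  n !                                       ∎

listings-ofLength : ∀ n → All (λ π → length π ≡ n) (listings n)
listings-ofLength n = filter⁺ _ (allLists-ofLength n n)

admissible⇒sorted : ∀ {k} I (s : List (Fin k)) → admissible I s ≡ true → Linked Fin._≤_ s
admissible⇒sorted I        []          _   = []
admissible⇒sorted I        (x ∷ [])    _   = [-]
admissible⇒sorted []       (x ∷ y ∷ s) ()
admissible⇒sorted (b ∷ bs) (x ∷ y ∷ s) adm with x ≤? y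
... | yes x≤y = x≤y ∷ admissible⇒sorted bs (y ∷ s) (∧-conicalʳ _ _ adm)
... | no _    with () ← adm

strictlyIncreasing⇒admissible : ∀ {k} I (t : List (Fin k)) → Linked Fin._<_ t → length t ≤ suc (length I) →
                    admissible I t ≡ true
strictlyIncreasing⇒admissible I        []          _            _         = refl
strictlyIncreasing⇒admissible I        (x ∷ [])    _            _         = refl
strictlyIncreasing⇒admissible []       (x ∷ y ∷ t) _            (s≤s ())
strictlyIncreasing⇒admissible (b ∷ bs) (x ∷ y ∷ t) (x<y ∷ y∷t↑) (s≤s |t|≤|bs|) = begin
  ⌊ x ≤? y ⌋ ∧ (not b ∨ ⌊ x <? y ⌋) ∧ admissible bs (y ∷ t)
    ≡⟨ cong₂ (λ p q → p ∧ (not b ∨ q) ∧ admissible bs (y ∷ t))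
             (⌊⌋-yes (x ≤? y) (<⇒≤ x<y)) (⌊⌋-yes (x <? y) x<y) ⟩
  (not b ∨ true) ∧ admissible bs (y ∷ t)
    ≡⟨ cong (_∧ admissible bs (y ∷ t)) (∨-zeroʳ (not b)) ⟩
  admissible bs (y ∷ t)
    ≡⟨ strictlyIncreasing⇒admissible bs (y ∷ t) y∷t↑ |t|≤|bs| ⟩
  true
    ∎

tabulate-strictlyIncreasing : ∀ {n k} {f : Fin n → Fin k} →
                              (∀ {i j} → i Fin.< j → f i Fin.< f j) → Linked Fin._<_ (tabulate f)
tabulate-strictlyIncreasing {zero}        _      = []
tabulate-strictlyIncreasing {suc zero}    _      = [-]
tabulate-strictlyIncreasing {suc (suc n)} f-mono = f-mono z<s ∷ tabulate-strictlyIncreasing (f-mono ∘ s<s)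

allFin-strictlyIncreasing : ∀ n → Linked Fin._<_ (allFin n)
allFin-strictlyIncreasing n = tabulate-strictlyIncreasing id

occurrences-head : ∀ {k} (x : Fin k) s → occurrences x (x ∷ s) ≡ suc (occurrences x s)
occurrences-head x s = cong (λ b → ⟦ b ⟧ + occurrences x s) (⌊⌋-yes (x ≟ x) refl)

occurrences-below : ∀ {k} {m x : Fin k} {s} → Linked Fin._≤_ (x ∷ s) → m Fin.< x → occurrences m (x ∷ s) ≡ 0
occurrences-below {m = m} {x} {s} x∷s↑ m<x =
  cong₂ _+_ (cong ⟦_⟧ (⌊⌋-no (m ≟ x) (<⇒≢ m<x))) (below-tail s x∷s↑)
  where
  below-tail : ∀ s → Linked Fin._≤_ (x ∷ s) → occurrences m s ≡ 0
  below-tail []      _              = refl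
  below-tail (y ∷ s) (x≤y ∷ y∷s↑) = occurrences-below y∷s↑ (<-≤-trans m<x x≤y)

sorted-unique : ∀ {k} {s t : List (Fin k)} → Linked Fin._≤_ s → Linked Fin._≤_ t →
                (∀ m → occurrences m s ≡ occurrences m t) → s ≡ t
sorted-unique {s = []}    {[]}    _ _ _ = refl
sorted-unique {s = []}    {y ∷ t} _ _ same = contradiction (trans (same y) (occurrences-head y t)) 0≢1+n
sorted-unique {s = x ∷ s} {[]}    _ _ same = contradiction (trans (sym (same x)) (occurrences-head x s)) 0≢1+n
sorted-unique {s = x ∷ s} {y ∷ t} x∷s↑ y∷t↑ same with <-cmp x y
... | tri< x<y _ _ =
  contradiction (trans (sym (occurrences-head x s)) (trans (same x) (occurrences-below y∷t↑ x<y))) 1+n≢0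
... | tri> _ _ y<x =
  contradiction (trans (sym (occurrences-head y t)) (trans (sym (same y)) (occurrences-below x∷s↑ y<x))) 1+n≢0
... | tri≈ _ refl _ = cong (x ∷_) (sorted-unique (Linked.tail x∷s↑) (Linked.tail y∷t↑)
                                     (λ m → +-cancelˡ-≡ ⟦ ⌊ m ≟ x ⌋ ⟧ _ _ (same m)))

expVec-injective-sorted : ∀ {k} {s t : List (Fin k)} → Linked Fin._≤_ s → Linked Fin._≤_ t →
                          expVec s ≡ expVec t → s ≡ t
expVec-injective-sorted {s = s} {t} s↑ t↑ eq = sorted-unique s↑ t↑ λ m → begin
  occurrences m s                      ≡⟨ lookup∘tabulate (λ m → occurrences m s) m ⟨
  lookup (expVec s) m                  ≡⟨ cong (λ v → lookup v m) eq ⟩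
  lookup (expVec t) m                  ≡⟨ lookup∘tabulate (λ m → occurrences m t) m ⟩
  occurrences m t                      ∎

_≟ᵥ_ : ∀ {k} → DecidableEquality (Vec ℕ k)
_≟ᵥ_ = ≡-decᵥ ℕ._≟_

admissible-expVec-unique : ∀ {k} I (s t : List (Fin k)) → Linked Fin._≤_ t →
  ⟦ admissible I s ⟧ * ⟦ ⌊ expVec s ≟ᵥ expVec t ⌋ ⟧ ≡ ⟦ admissible I t ⟧ * ⟦ ⌊ s ≟ₗ t ⌋ ⟧
admissible-expVec-unique I s t t↑ with s ≟ₗ t
... | yes refl = cong (λ b → ⟦ admissible I s ⟧ * ⟦ b ⟧) (⌊⌋-yes (expVec s ≟ᵥ expVec s) refl)
... | no s≢t with admissible I s in adm
...   | false = sym (*-zeroʳ ⟦ admissible I t ⟧)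
...   | true  = begin
  1 * ⟦ ⌊ expVec s ≟ᵥ expVec t ⌋ ⟧  ≡⟨ cong (λ b → 1 * ⟦ b ⟧) (⌊⌋-no (expVec s ≟ᵥ expVec t) s≁t) ⟩
  0                                 ≡⟨ *-zeroʳ ⟦ admissible I t ⟧ ⟨
  ⟦ admissible I t ⟧ * 0            ∎
  where
  s≁t : expVec s ≢ expVec t
  s≁t = s≢t ∘ expVec-injective-sorted (admissible⇒sorted I s adm) t↑

coeffF-sorted : ∀ m I k (t : List (Fin k)) → Linked Fin._≤_ t →
                coeffF m I k (expVec t) ≡ ⟦ admissible I t ⟧ * ⟦ ⌊ length t ℕ.≟ m ⌋ ⟧
coeffF-sorted m I k t t↑ = begin
  coeffF m I k (expVec t)
    ≡⟨ length-filter (λ s → ⌊ expVec s ≟ᵥ expVec t ⌋) (filter (λ s → admissible I s ≟ᵇ true) (allLists m k)) ⟩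
  ∑[ s ∈ filter (λ s → admissible I s ≟ᵇ true) (allLists m k) ] ⟦ ⌊ expVec s ≟ᵥ expVec t ⌋ ⟧
    ≡⟨ ∑-filter (admissible I) (λ s → ⟦ ⌊ expVec s ≟ᵥ expVec t ⌋ ⟧) (allLists m k) ⟩
  ∑[ s ∈ allLists m k ] (⟦ admissible I s ⟧ * ⟦ ⌊ expVec s ≟ᵥ expVec t ⌋ ⟧)
    ≡⟨ ∑-cong (λ s → admissible-expVec-unique I s t t↑) (allLists m k) ⟩
  ∑[ s ∈ allLists m k ] (⟦ admissible I t ⟧ * ⟦ ⌊ s ≟ₗ t ⌋ ⟧)
    ≡⟨ ∑-*ˡ ⟦ admissible I t ⟧ (λ s → ⟦ ⌊ s ≟ₗ t ⌋ ⟧) (allLists m k) ⟩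
  ⟦ admissible I t ⟧ * ∑[ s ∈ allLists m k ] ⟦ ⌊ s ≟ₗ t ⌋ ⟧
    ≡⟨ cong (⟦ admissible I t ⟧ *_) (∑-allLists-≟ m t) ⟩
  ⟦ admissible I t ⟧ * ⟦ ⌊ length t ℕ.≟ m ⌋ ⟧
    ∎

length-xdes : ∀ {n} (E : Digraph n) π → length π ≤ suc (length (xdes E π))
length-xdes E []          = z≤n
length-xdes E (x ∷ [])    = ≤-refl
length-xdes E (x ∷ y ∷ π) = s≤s (length-xdes E (y ∷ π))

coeffF-allFin : ∀ m I n → m ≤ suc (length I) → coeffF m I n (expVec (allFin n)) ≡ ⟦ ⌊ n ℕ.≟ m ⌋ ⟧
coeffF-allFin m I n m≤1+|I| = begin
  coeffF m I n (expVec (allFin n))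
    ≡⟨ coeffF-sorted m I n (allFin n) (Linked.map <⇒≤ (allFin-strictlyIncreasing n)) ⟩
  ⟦ admissible I (allFin n) ⟧ * ⟦ ⌊ length (allFin n) ℕ.≟ m ⌋ ⟧
    ≡⟨ cong (λ l → ⟦ admissible I (allFin n) ⟧ * ⟦ ⌊ l ℕ.≟ m ⌋ ⟧) (length-tabulate id) ⟩
  ⟦ admissible I (allFin n) ⟧ * ⟦ ⌊ n ℕ.≟ m ⌋ ⟧
    ≡⟨ admissible-when-n≡m ⟩
  ⟦ ⌊ n ℕ.≟ m ⌋ ⟧
    ∎
  where
  admissible-when-n≡m : ⟦ admissible I (allFin n) ⟧ * ⟦ ⌊ n ℕ.≟ m ⌋ ⟧ ≡ ⟦ ⌊ n ℕ.≟ m ⌋ ⟧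
  admissible-when-n≡m with n ℕ.≟ m
  ... | no _     = *-zeroʳ ⟦ admissible I (allFin n) ⟧
  ... | yes refl = cong (λ b → ⟦ b ⟧ * 1) (strictlyIncreasing⇒admissible I (allFin n)
                     (allFin-strictlyIncreasing n) (subst (_≤ suc (length I)) (sym (length-tabulate id)) m≤1+|I|))

coeffU-allFin : ∀ {m} (E : Digraph m) n → coeffU E n (expVec (allFin n)) ≡ ⟦ ⌊ n ℕ.≟ m ⌋ ⟧ * m !
coeffU-allFin {m} E n = begin
  ∑[ π ∈ listings m ] coeffF m (xdes E π) n (expVec (allFin n))
    ≡⟨ ∑-cong-All (λ {π} → coeffF-listing π) (listings-ofLength m) ⟩
  ∑[ _ ∈ listings m ] ⟦ ⌊ n ℕ.≟ m ⌋ ⟧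
    ≡⟨ ∑-const _ (listings m) ⟩
  ⟦ ⌊ n ℕ.≟ m ⌋ ⟧ * length (listings m)
    ≡⟨ cong (⟦ ⌊ n ℕ.≟ m ⌋ ⟧ *_) (length-listings m) ⟩
  ⟦ ⌊ n ℕ.≟ m ⌋ ⟧ * m !
    ∎
  where
  coeffF-listing : ∀ π → length π ≡ m → coeffF m (xdes E π) n (expVec (allFin n)) ≡ ⟦ ⌊ n ℕ.≟ m ⌋ ⟧
  coeffF-listing π |π|≡m =
    coeffF-allFin m (xdes E π) n (subst (_≤ suc (length (xdes E π))) |π|≡m (length-xdes E π))

vertexCount-determined : ∀ {n m} (X : Digraph n) (Y : Digraph m) → X ≐U Y → n ≡ m
vertexCount-determined {n} {m} X Y X≐Y with n ℕ.≟ m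
... | yes n≡m = n≡m
... | no n≢m  = contradiction n!≡0 (ℕ.≢-nonZero⁻¹ (n !) {{n !≢0}})
  where
  a : Vec ℕ n
  a = expVec (allFin n)
  n!≡0 : n ! ≡ 0
  n!≡0 = begin
    n !                    ≡⟨ *-identityˡ (n !) ⟨
    ⟦ true ⟧ * n !         ≡⟨ cong (λ b → ⟦ b ⟧ * n !) (⌊⌋-yes (n ℕ.≟ n) refl) ⟨
    ⟦ ⌊ n ℕ.≟ n ⌋ ⟧ * n !  ≡⟨ coeffU-allFin X n ⟨
    coeffU X n a           ≡⟨ X≐Y n a ⟩
    coeffU Y n a           ≡⟨ coeffU-allFin Y n ⟩
    ⟦ ⌊ n ℕ.≟ m ⌋ ⟧ * m !  ≡⟨ cong (λ b → ⟦ b ⟧ * m !) (⌊⌋-no (n ℕ.≟ m) n≢m) ⟩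
    0                      ∎

startsWithEdge : ∀ {n} → Digraph n → List (Fin n) → Bool
startsWithEdge E (u ∷ v ∷ _) = E u v
startsWithEdge E _           = false

coeffF-x₀² : ∀ r b I → suc r ≤ suc (length I) →
             coeffF (2 + r) (b ∷ I) (suc r) (expVec (zero ∷ allFin (suc r))) ≡ ⟦ not b ⟧
coeffF-x₀² r b I 1+r≤1+|I| = begin
  coeffF (2 + r) (b ∷ I) (suc r) (expVec t)
    ≡⟨ coeffF-sorted (2 + r) (b ∷ I) (suc r) t (z≤n ∷ Linked.map <⇒≤ (allFin-strictlyIncreasing (suc r))) ⟩
  ⟦ (not b ∨ false) ∧ admissible I (allFin (suc r)) ⟧ * ⟦ ⌊ length t ℕ.≟ 2 + r ⌋ ⟧
    ≡⟨ cong₂ (λ p q → ⟦ p ∧ q ⟧ * ⟦ ⌊ length t ℕ.≟ 2 + r ⌋ ⟧) (∨-identityʳ (not b))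
             (strictlyIncreasing⇒admissible I (allFin (suc r)) (allFin-strictlyIncreasing (suc r)) |allFin|≤1+|I|) ⟩
  ⟦ not b ∧ true ⟧ * ⟦ ⌊ length t ℕ.≟ 2 + r ⌋ ⟧
    ≡⟨ cong₂ (λ p q → ⟦ p ⟧ * ⟦ q ⟧) (∧-identityʳ (not b)) (⌊⌋-yes (length t ℕ.≟ 2 + r) |t|≡2+r) ⟩
  ⟦ not b ⟧ * 1
    ≡⟨ *-identityʳ ⟦ not b ⟧ ⟩
  ⟦ not b ⟧
    ∎
  where
  t : List (Fin (suc r))
  t = zero ∷ allFin (suc r)
  |t|≡2+r : length t ≡ 2 + r
  |t|≡2+r = cong suc (length-tabulate id)
  |allFin|≤1+|I| : length (allFin (suc r)) ≤ suc (length I)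
  |allFin|≤1+|I| = subst (_≤ suc (length I)) (sym (length-tabulate id)) 1+r≤1+|I|

coeffU-x₀² : ∀ r (E : Digraph (2 + r)) →
             coeffU E (suc r) (expVec (zero ∷ allFin (suc r)))
               ≡ ∑[ π ∈ listings (2 + r) ] ⟦ not (startsWithEdge E π) ⟧
coeffU-x₀² r E = ∑-cong-All (λ {π} → coeffF-listing π) (listings-ofLength (2 + r))
  where
  coeffF-listing : ∀ π → length π ≡ 2 + r →
    coeffF (2 + r) (xdes E π) (suc r) (expVec (zero ∷ allFin (suc r))) ≡ ⟦ not (startsWithEdge E π) ⟧
  coeffF-listing (u ∷ v ∷ π) |π|≡2+r = coeffF-x₀² r (E u v) (xdes E (v ∷ π))
    (subst (_≤ suc (length (xdes E (v ∷ π)))) (cong ℕ.pred |π|≡2+r) (length-xdes E (v ∷ π)))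

∑-listings-startsWithEdge : ∀ r (E : Digraph (2 + r)) →
  ∑[ π ∈ listings (2 + r) ] ⟦ startsWithEdge E π ⟧ ≡ nonLoopEdges E * r !
∑-listings-startsWithEdge r E = begin
  ∑[ π ∈ listings n ] ⟦ startsWithEdge E π ⟧
    ≡⟨ ∑-filter distinct (λ π → ⟦ startsWithEdge E π ⟧) (allLists n n) ⟩
  ∑[ s ∈ allLists n n ] (⟦ distinct s ⟧ * ⟦ startsWithEdge E s ⟧)
    ≡⟨ ∑-allLists-suc (suc r) n _ ⟩
  ∑[ u ∈ allFin n ] ∑[ s ∈ allLists (suc r) n ] (⟦ distinct (u ∷ s) ⟧ * ⟦ startsWithEdge E (u ∷ s) ⟧)
    ≡⟨ ∑-cong (λ u → ∑-allLists-suc r n _) (allFin n) ⟩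
  ∑[ u ∈ allFin n ] ∑[ v ∈ allFin n ] ∑[ s ∈ allLists r n ] (⟦ distinct (u ∷ v ∷ s) ⟧ * ⟦ E u v ⟧)
    ≡⟨ ∑-cong (λ u → ∑-cong (listings-starting-with u) (allFin n)) (allFin n) ⟩
  ∑[ u ∈ allFin n ] ∑[ v ∈ allFin n ] (⟦ E u v ∧ not ⌊ u ≟ v ⌋ ⟧ * r !)
    ≡⟨ ∑-cong (λ u → ∑-*ʳ (r !) (λ v → ⟦ E u v ∧ not ⌊ u ≟ v ⌋ ⟧) (allFin n)) (allFin n) ⟩
  ∑[ u ∈ allFin n ] (∑[ v ∈ allFin n ] ⟦ E u v ∧ not ⌊ u ≟ v ⌋ ⟧ * r !)
    ≡⟨ ∑-*ʳ (r !) (λ u → ∑[ v ∈ allFin n ] ⟦ E u v ∧ not ⌊ u ≟ v ⌋ ⟧) (allFin n) ⟩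
  nonLoopEdges E * r !
    ∎
  where
  n : ℕ
  n = 2 + r
  listings-starting-with : ∀ u v →
    ∑[ s ∈ allLists r n ] (⟦ distinct (u ∷ v ∷ s) ⟧ * ⟦ E u v ⟧) ≡ ⟦ E u v ∧ not ⌊ u ≟ v ⌋ ⟧ * r !
  listings-starting-with u v = begin
    ∑[ s ∈ allLists r n ] (⟦ distinct (u ∷ v ∷ s) ⟧ * ⟦ E u v ⟧)
      ≡⟨ ∑-cong (λ s → *-comm ⟦ distinct (u ∷ v ∷ s) ⟧ ⟦ E u v ⟧) (allLists r n) ⟩
    ∑[ s ∈ allLists r n ] (⟦ E u v ⟧ * ⟦ distinct (u ∷ v ∷ s) ⟧)
      ≡⟨ ∑-*ˡ ⟦ E u v ⟧ (λ s → ⟦ distinct (u ∷ v ∷ s) ⟧) (allLists r n) ⟩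
    ⟦ E u v ⟧ * ∑[ s ∈ allLists r n ] ⟦ distinct ((u ∷ v ∷ []) ++ s) ⟧
      ≡⟨ cong (⟦ E u v ⟧ *_) (∑-distinct-++ r (u ∷ v ∷ []) refl) ⟩
    ⟦ E u v ⟧ * (⟦ distinct (u ∷ v ∷ []) ⟧ * r !)
      ≡⟨ *-assoc ⟦ E u v ⟧ _ (r !) ⟨
    ⟦ E u v ⟧ * ⟦ distinct (u ∷ v ∷ []) ⟧ * r !
      ≡⟨ cong (_* r !) (⟦∧⟧ (E u v) (distinct (u ∷ v ∷ []))) ⟨
    ⟦ E u v ∧ distinct (u ∷ v ∷ []) ⟧ * r !
      ≡⟨ cong (λ b → ⟦ E u v ∧ b ⟧ * r !) (trans (∧-identityʳ _) (∧-identityʳ _)) ⟩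
    ⟦ E u v ∧ not ⌊ u ≟ v ⌋ ⟧ * r !
      ∎

coeffU-x₀²+nonLoopEdges : ∀ r (E : Digraph (2 + r)) →
  coeffU E (suc r) (expVec (zero ∷ allFin (suc r))) + nonLoopEdges E * r ! ≡ (2 + r) !
coeffU-x₀²+nonLoopEdges r E = begin
  coeffU E (suc r) (expVec (zero ∷ allFin (suc r))) + nonLoopEdges E * r !
    ≡⟨ cong₂ _+_ (coeffU-x₀² r E) (sym (∑-listings-startsWithEdge r E)) ⟩
  ∑[ π ∈ listings (2 + r) ] ⟦ not (startsWithEdge E π) ⟧ + ∑[ π ∈ listings (2 + r) ] ⟦ startsWithEdge E π ⟧
    ≡⟨ ∑-not (startsWithEdge E) (listings (2 + r)) ⟩
  length (listings (2 + r))
    ≡⟨ length-listings (2 + r) ⟩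
  (2 + r) !
    ∎

nonLoopEdges-Fin1 : (E : Digraph 1) → nonLoopEdges E ≡ 0
nonLoopEdges-Fin1 E with E zero zero
... | true  = refl
... | false = refl

nonLoopEdges-determined : ∀ {n} (X Y : Digraph n) → X ≐U Y → nonLoopEdges X ≡ nonLoopEdges Y
nonLoopEdges-determined {zero}        X Y _   = refl
nonLoopEdges-determined {suc zero}    X Y _   = trans (nonLoopEdges-Fin1 X) (sym (nonLoopEdges-Fin1 Y))
nonLoopEdges-determined {suc (suc r)} X Y X≐Y =
  *-cancelʳ-≡ _ _ (r !) {{r !≢0}} (+-cancelˡ-≡ (coeffU X (suc r) a) _ _ (begin
    coeffU X (suc r) a + nonLoopEdges X * r !  ≡⟨ coeffU-x₀²+nonLoopEdges r X ⟩
    (2 + r) !                                  ≡⟨ coeffU-x₀²+nonLoopEdges r Y ⟨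
    coeffU Y (suc r) a + nonLoopEdges Y * r !  ≡⟨ cong (_+ nonLoopEdges Y * r !) (X≐Y (suc r) a) ⟨
    coeffU X (suc r) a + nonLoopEdges Y * r !  ∎))
  where
  a : Vec ℕ (suc r)
  a = expVec (zero ∷ allFin (suc r))

mainTheorem9 : (n m : ℕ) (X : Digraph n) (Y : Digraph m) →
    X ≐U Y → (n ≡ m) × (nonLoopEdges X ≡ nonLoopEdges Y)
mainTheorem9 n m X Y X≐Y with refl ← vertexCount-determined X Y X≐Y =
  refl , nonLoopEdges-determined X Y X≐Y
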